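{- Let $M$ be a transversal matroid of rank $r$ on $E$, and let $\mathcal{A}$ and $\mathcal{B}$ be presentations of $M$ with $\mathcal{A}\prec\mathcal{B}$. Then $L_\mathcal{B}$ (which is a sublattice of $L_\mathcal{A}$) is a proper sublattice of $L_\mathcal{A}$ if either of the following holds: (1) there are $e\in E$ and $h\in s_\mathcal{A}(e)$ with $s_\mathcal{A}(e)-\{h\}\in L_\mathcal{B}$ and $s_\mathcal{A}(e)\neq s_\mathcal{B}(e)$; (2) for each $I\in 2^{[r]}-L_\mathcal{B}$ there is some $h\in I$ with $I-\{h\}\in L_\mathcal{B}$.
   Context: $[r]=\{1,\dots,r\}$. For a set system $\mathcal{A}=(A_i:i\in[r])$ on a finite set $E$, $M[\mathcal{A}]$ is the transversal matroid on $E$ whose independent sets are the partial transversals of $\mathcal{A}$; $\mathcal{A}$ is a presentation of $M[\mathcal{A}]$, and presentations of a rank-$r$ matroid are taken to have exactly $r$ sets. $\mathcal{A}\prec\mathcal{B}$ means $A_i\subseteq B_i$ for all $i$ with at least one inclusion strict. $s_\mathcal{A}(X)=\{i: X\cap A_i\neq\emptyset\}$, $s_\mathcal{A}(e)=s_\mathcal{A}(\{e\})$. Fix $x\notin E$; for $I\subseteq[r]$, $\mathcal{A}^I$ is obtained from $\mathcal{A}$ by replacing $A_i$ by $A_i\cup\{x\}$ for each $i\in I$. Let $\sigma_\mathcal{A}(I)=I\cup\{k\in[r]-I: x\text{ is a coloop of } M[\mathcal{A}^I]\backslash A_k\}$; $L_\mathcal{A}$ is the lattice of $I\subseteq[r]$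 with $\sigma_\mathcal{A}(I)=I$ (join $\cup$, meet $\cap$); similarly $L_\mathcal{B}$. -}

module Defs where

open import Data.Nat using (ℕ; suc; _≤_)
open import Data.Sum using (_⊎_)
open import Data.Fin using (Fin; zero; suc)
open import Data.Fin.Subset using (Subset; _∈_; _∉_; _⊆_; _∪_; ∁; ⁅_⁆; ∣_∣)
open import Data.Vec using (Vec; _∷_; lookup; tabulate)
open import Data.Bool using (Bool; true; false)
open import Data.Product using (Σ; ∃; _×_; _,_)
open import Relation.Nullary using (¬_)
open import Relation.Binary.PropositionalEquality using (_≡_; _≢_)

SetSystem : ℕ → ℕ → Set
SetSystem n r = Fin r → Subset n

PartialTransversal : ∀ {n r} → SetSystem n r → Subset n → Set
PartialTransversal {n} {r} A X =
  Σ (Fin n → Fin r) λ φ →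
    (∀ e → e ∈ X → e ∈ A (φ e)) ×
    (∀ e e′ → e ∈ X → e′ ∈ X → φ e ≡ φ e′ → e ≡ e′)

Indep : ∀ {n r} → SetSystem n r → Subset n → Set
Indep = PartialTransversal

SameMatroid : ∀ {n r r′} → SetSystem n r → SetSystem n r′ → Set
SameMatroid {n} A B = ∀ (X : Subset n) → (Indep A X → Indep B X) × (Indep B X → Indep A X)

HasRank : ∀ {n r} → SetSystem n r → ℕ → Set
HasRank {n} A k =
  (Σ (Subset n) λ X → Indep A X × ∣ X ∣ ≡ k) ×
  (∀ (X : Subset n) → Indep A X → ∣ X ∣ ≤ k)

_≺_ : ∀ {n r} → SetSystem n r → SetSystem n r → Set
_≺_ {n} {r} A B = (∀ i → A i ⊆ B i) × ∃ λ i → A i ≢ B i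

s : ∀ {n r} → SetSystem n r → Fin n → Subset r
s A e = tabulate λ i → lookup (A i) e

-- The extended ground set E ∪ {x} is Fin (suc n) with x = zero and e ∈ E as suc e.
-- A^I : replace A_i by A_i ∪ {x} for i ∈ I.
extend : ∀ {n r} → SetSystem n r → Subset r → SetSystem (suc n) r
extend A I i = lookup I i ∷ A i

IsBasisOf : ∀ {m r} → SetSystem m r → Subset m → Subset m → Set
IsBasisOf A S B =
  B ⊆ S × Indep A B × (∀ y → y ∈ S → y ∉ B → ¬ Indep A (B ∪ ⁅ y ⁆))

IsColoop : ∀ {m r} → SetSystem m r → Subset m → Fin m → Set
IsColoop {m} A S y = y ∈ S × (∀ (B : Subset m) → IsBasisOf A S B → y ∈ B)

-- x is a coloop of M[A^I] \ A_k (deletion of the elements of A_k;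
-- the ground set of the deletion is (E ∪ {x}) − A_k).
XColoopDel : ∀ {n r} → SetSystem n r → Subset r → Fin r → Set
XColoopDel A I k = IsColoop (extend A I) (true ∷ ∁ (A k)) zero

InSigma : ∀ {n r} → SetSystem n r → Subset r → Fin r → Set
InSigma A I k = k ∈ I ⊎ (k ∉ I × XColoopDel A I k)

-- I ∈ L_A  iff  σ_A(I) = I  (σ_A(I) ⊇ I always, so this says σ_A(I) ⊆ I).
InL : ∀ {n r} → SetSystem n r → Subset r → Set
InL A I = ∀ k → InSigma A I k → k ∈ I

module Submission where

-- The
-- proof rests on three facts about x being a coloop of M[A^I] \ A_k:
--
--   (coloop-transfer)     it passes from A to B, hence L_B ⊆ L_A;
--   (coloop-at-new-index) if e ∈ B_j then x is a coloop of M[B^{s_A(e)}] \ B_j,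
--                         so s_A(e) ∉ L_B as soon as s_B(e) ⊋ s_A(e);
--   (coloop-drop-index)   for h ∈ s_A(e) and k ∉ s_A(e) it passes from
--                         I = s_A(e) to I − h, so s_A(e) ∈ L_A as soon as
--                         s_A(e) − h ∈ L_B.
--
-- Each is proved by contradiction: a basis avoiding x is enlarged by x (or by
-- e), contradicting maximality.

open import Defs
open import Data.Nat using (ℕ; suc)
open import Data.Fin using (Fin; zero; suc; _≟_)
open import Data.Fin.Properties using (¬∀⟶∃¬; suc-injective)
open import Data.Fin.Subset
  using (Subset; _∈_; _∉_; _⊆_; _∪_; _-_; ⁅_⁆; ∁; inside; outside)
open import Data.Fin.Subset.Properties
  using (_∈?_; x∈p∪q⁻; x∈p∪q⁺; x∈⁅x⁆; x∈⁅y⁆⇒x≡y; drop-there; x∈∁p⇒x∉p;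
         x∉p⇒x∈∁p; x∈p∧x≢y⇒x∈p-y; p─q⊆p; ⊆-antisym; ⊆-refl; ⊆-trans; s⊆s;
         p⊆q⇒∁p⊇∁q; ∪-identityʳ)
open import Data.Vec using (_∷_; lookup; here; there)
open import Data.Vec.Properties using ([]=⇒lookup; lookup⇒[]=; lookup∘tabulate)
open import Data.List using (List; []; _∷_; allFin)
open import Data.List.Relation.Unary.All as All using (All; []; _∷_)
open import Data.List.Membership.Propositional.Properties using (∈-allFin)
open import Data.Product using (Σ; _×_; _,_; proj₁; proj₂)
open import Data.Sum using (_⊎_; inj₁; inj₂; [_,_]; [_,_]′)
open import Data.Empty using (⊥-elim)
open import Function using (id; _∘_)
open import Function.Definitions using (Injective)
open import Relation.Nullary using (¬_; Dec; yes; no)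
open import Relation.Nullary.Decidable using (¬¬-excluded-middle; decidable-stable; _→-dec_)
open import Relation.Nullary.Negation using (contradiction)
open import Relation.Binary.PropositionalEquality
  using (_≡_; _≢_; refl; sym; trans; cong; subst; module ≡-Reasoning)

private variable
  m n r : ℕ

∈-∪⁅⁆ˡ : ∀ {T : Subset m} {y z} → y ∈ T → y ∈ T ∪ ⁅ z ⁆
∈-∪⁅⁆ˡ y∈T = x∈p∪q⁺ (inj₁ y∈T)

∈-∪⁅⁆ʳ : ∀ {T : Subset m} {z} → z ∈ T ∪ ⁅ z ⁆
∈-∪⁅⁆ʳ {z = z} = x∈p∪q⁺ (inj₂ (x∈⁅x⁆ z))

∈-∪⁅⁆⁻ : ∀ {T : Subset m} {y z} → y ∈ T ∪ ⁅ z ⁆ → y ≢ z → y ∈ T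
∈-∪⁅⁆⁻ {T = T} {z = z} y∈ y≢z =
  [ id , (λ y∈⁅z⁆ → contradiction (x∈⁅y⁆⇒x≡y z y∈⁅z⁆) y≢z) ] (x∈p∪q⁻ T ⁅ z ⁆ y∈)

∪⁅⁆-mono : ∀ {T T₁ : Subset m} {z} → T ⊆ T₁ → T ∪ ⁅ z ⁆ ⊆ T₁ ∪ ⁅ z ⁆
∪⁅⁆-mono {z = z} T⊆T₁ {y} y∈ with y ≟ z
... | yes refl = ∈-∪⁅⁆ʳ
... | no y≢z = ∈-∪⁅⁆ˡ (T⊆T₁ (∈-∪⁅⁆⁻ y∈ y≢z))

∪⁅⁆-least : ∀ {T S : Subset m} {z} → T ⊆ S → z ∈ S → T ∪ ⁅ z ⁆ ⊆ S
∪⁅⁆-least {z = z} T⊆S z∈S {y} y∈ with y ≟ z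
... | yes refl = z∈S
... | no y≢z = T⊆S (∈-∪⁅⁆⁻ y∈ y≢z)

x-adjoined : (T : Subset m) → (outside ∷ T) ∪ ⁅ zero ⁆ ≡ inside ∷ T
x-adjoined T = cong (inside ∷_) (∪-identityʳ T)

x∷-⊆ : ∀ {T : Subset m} {U} → zero ∈ U → outside ∷ T ⊆ U → inside ∷ T ⊆ U
x∷-⊆ x∈U T⊆U here = x∈U
x∷-⊆ x∈U T⊆U (there y∈T) = T⊆U (there y∈T)

⊆-≢-witness : ∀ {p q : Subset m} → p ⊆ q → p ≢ q → Σ (Fin m) λ j → j ∈ q × j ∉ p
⊆-≢-witness {m} {p} {q} p⊆q p≢q =
  let j , q⇏p = ¬∀⟶∃¬ m (λ j → j ∈ q → j ∈ p) (λ j → j ∈? q →-dec j ∈? p)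
                  (λ q⊆p → p≢q (⊆-antisym p⊆q (λ {j} → q⊆p j)))
  in j , decidable-stable (j ∈? q) (λ j∉q → q⇏p (λ j∈q → contradiction j∈q j∉q))
       , λ j∈p → q⇏p (λ _ → j∈p)

∈s⇒∈ : ∀ {A : SetSystem n r} {e i} → i ∈ s A e → e ∈ A i
∈s⇒∈ {A = A} {e} {i} i∈s =
  lookup⇒[]= e (A i) (trans (sym (lookup∘tabulate (λ i → lookup (A i) e) i)) ([]=⇒lookup i∈s))

∈⇒∈s : ∀ {A : SetSystem n r} {e i} → e ∈ A i → i ∈ s A e
∈⇒∈s {A = A} {e} {i} e∈Aᵢ =
  lookup⇒[]= i (s A e) (trans (lookup∘tabulate (λ i → lookup (A i) e) i) ([]=⇒lookup e∈Aᵢ))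

s-mono : ∀ {A B : SetSystem n r} → (∀ i → A i ⊆ B i) → ∀ e → s A e ⊆ s B e
s-mono {A = A} {B} A⊆B e i∈s = ∈⇒∈s {A = B} (A⊆B _ (∈s⇒∈ {A = A} i∈s))

x∈extend⁻ : ∀ {A : SetSystem n r} {I i} → zero ∈ extend A I i → i ∈ I
x∈extend⁻ {I = I} {i} x∈ = lookup⇒[]= i I ([]=⇒lookup x∈)

x∈extend⁺ : ∀ {A : SetSystem n r} {I i} → i ∈ I → zero ∈ extend A I i
x∈extend⁺ {A = A} {I} {i} i∈I = lookup⇒[]= zero (lookup I i ∷ A i) ([]=⇒lookup i∈I)

extend-mono : ∀ {A B : SetSystem n r} {I} → (∀ i → A i ⊆ B i) →
  ∀ i → extend A I i ⊆ extend B I i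
extend-mono A⊆B i = s⊆s (A⊆B i)

DelGround : SetSystem n r → Fin r → Subset (suc n)
DelGround A k = inside ∷ ∁ (A k)

Indep-reindex : ∀ {C C′ : SetSystem m r} {X Y} (w : Indep C X) (τ : Fin m → Fin m) →
  Injective _≡_ _≡_ τ → (∀ y → y ∈ Y → τ y ∈ X) →
  (∀ y → y ∈ Y → y ∈ C′ (proj₁ w (τ y))) → Indep C′ Y
Indep-reindex (φ , _ , φ-inj) τ τ-inj τ[Y]⊆X mem =
  φ ∘ τ , mem , λ y y′ y∈Y y′∈Y eq → τ-inj (φ-inj _ _ (τ[Y]⊆X y y∈Y) (τ[Y]⊆X y′ y′∈Y) eq)

Indep-transfer : ∀ {C C′ : SetSystem m r} {X Y} (w : Indep C X) → Y ⊆ X →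
  (∀ y → y ∈ Y → y ∈ C′ (proj₁ w y)) → Indep C′ Y
Indep-transfer {C = C} {C′} w Y⊆X = Indep-reindex {C = C} {C′} w id id (λ _ → Y⊆X)

Indep-⊆ : ∀ {C : SetSystem m r} {X Y} → Y ⊆ X → Indep C X → Indep C Y
Indep-⊆ {C = C} Y⊆X w =
  Indep-transfer {C = C} {C} w Y⊆X (λ y y∈Y → proj₁ (proj₂ w) y (Y⊆X y∈Y))

Indep-mono : ∀ {C C′ : SetSystem m r} {X} → (∀ i → C i ⊆ C′ i) → Indep C X → Indep C′ X
Indep-mono {C = C} {C′} C⊆C′ w =
  Indep-transfer {C = C} {C′} w ⊆-refl (λ y y∈X → C⊆C′ _ (proj₁ (proj₂ w) y y∈X))

Indep-add : ∀ {C : SetSystem m r} {T y i} → Indep C T → y ∈ C i →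
  (∀ {t} → t ∈ T → t ∉ C i) → Indep C (T ∪ ⁅ y ⁆)
Indep-add {C = C} {T} {y} {i} (φ , φ-mem , φ-inj) y∈Cᵢ T∩Cᵢ=∅ = ψ , ψ-mem , ψ-inj
  where
  ψ : Fin _ → Fin _
  ψ t with t ≟ y
  ... | yes _ = i
  ... | no _ = φ t

  φ≢i : ∀ {t} → t ∈ T → φ t ≢ i
  φ≢i t∈T φt≡i = T∩Cᵢ=∅ t∈T (subst (λ j → _ ∈ C j) φt≡i (φ-mem _ t∈T))

  ψ-mem : ∀ t → t ∈ T ∪ ⁅ y ⁆ → t ∈ C (ψ t)
  ψ-mem t t∈ with t ≟ y
  ... | yes refl = y∈Cᵢ
  ... | no t≢y = φ-mem t (∈-∪⁅⁆⁻ t∈ t≢y)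

  ψ-inj : ∀ t t′ → t ∈ T ∪ ⁅ y ⁆ → t′ ∈ T ∪ ⁅ y ⁆ → ψ t ≡ ψ t′ → t ≡ t′
  ψ-inj t t′ t∈ t′∈ eq with t ≟ y | t′ ≟ y
  ... | yes t≡y | yes t′≡y = trans t≡y (sym t′≡y)
  ... | yes _   | no t′≢y  = ⊥-elim (φ≢i (∈-∪⁅⁆⁻ t′∈ t′≢y) (sym eq))
  ... | no t≢y  | yes _    = ⊥-elim (φ≢i (∈-∪⁅⁆⁻ t∈ t≢y) eq)
  ... | no t≢y  | no t′≢y  = φ-inj t t′ (∈-∪⁅⁆⁻ t∈ t≢y) (∈-∪⁅⁆⁻ t′∈ t′≢y) eq

lower : ∀ {A : SetSystem n r} {I b X} → Indep (extend A I) (b ∷ X) → Indep A X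
lower (φ , φ-mem , φ-inj) =
  φ ∘ suc , (λ y y∈X → drop-there (φ-mem (suc y) (there y∈X))) ,
  λ y y′ y∈X y′∈X eq → suc-injective (φ-inj (suc y) (suc y′) (there y∈X) (there y′∈X) eq)

-- A matching of A is one of A^I on a set avoiding x; x is sent to an
-- arbitrary index i, which is never used.
lift : ∀ {A : SetSystem n r} {I X} → Fin r → Indep A X → Indep (extend A I) (outside ∷ X)
lift {n} {r} {A} {I} {X} i (φ , φ-mem , φ-inj) = φ′ , φ′-mem , φ′-inj
  where
  φ′ : Fin (suc n) → Fin r
  φ′ zero = i
  φ′ (suc y) = φ y

  φ′-mem : ∀ y → y ∈ outside ∷ X → y ∈ extend A I (φ′ y)
  φ′-mem (suc y) (there y∈X) = there (φ-mem y y∈X)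

  φ′-inj : ∀ y y′ → y ∈ outside ∷ X → y′ ∈ outside ∷ X → φ′ y ≡ φ′ y′ → y ≡ y′
  φ′-inj (suc y) (suc y′) (there y∈X) (there y′∈X) eq = cong suc (φ-inj y y′ y∈X y′∈X eq)

-- A matching of A^I remains one of A^{I′} as long as x, if present, is sent
-- to an index of I′: the two systems differ only at x.
retarget : ∀ {A : SetSystem n r} {I I′ U} (w : Indep (extend A I) U) →
  (zero ∈ U → proj₁ w zero ∈ I′) → Indep (extend A I′) U
retarget {A = A} {I} {I′} {U} w x↦I′ =
  Indep-transfer {C = extend A I} {extend A I′} w ⊆-refl mem
  where
  mem : ∀ y → y ∈ U → y ∈ extend A I′ (proj₁ w y)
  mem zero x∈U = x∈extend⁺ {A = A} {I′} (x↦I′ x∈U)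
  mem (suc y) y∈U = there (drop-there (proj₁ (proj₂ w) (suc y) y∈U))

-- The transposition of x and e on E ∪ {x}; re-indexing along it lets x and
-- e exchange their roles in a matching.
swapₓ : Fin n → Fin (suc n) → Fin (suc n)
swapₓ e zero = suc e
swapₓ e (suc y) with y ≟ e
... | yes _ = zero
... | no _ = suc y

swapₓ-involutive : ∀ (e : Fin n) y → swapₓ e (swapₓ e y) ≡ y
swapₓ-involutive e zero with e ≟ e
... | yes _ = refl
... | no e≢e = contradiction refl e≢e
swapₓ-involutive e (suc y) with y ≟ e
... | yes refl = refl
... | no y≢e with y ≟ e
...   | yes y≡e = contradiction y≡e y≢e
...   | no _ = refl

swapₓ-injective : ∀ (e : Fin n) → Injective _≡_ _≡_ (swapₓ e)
swapₓ-injective e {y} {y′} eq = begin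
  y                        ≡⟨ sym (swapₓ-involutive e y) ⟩
  swapₓ e (swapₓ e y)      ≡⟨ cong (swapₓ e) eq ⟩
  swapₓ e (swapₓ e y′)     ≡⟨ swapₓ-involutive e y′ ⟩
  y′                       ∎
  where open ≡-Reasoning

x-for-e : ∀ {A : SetSystem n r} {I X e} (w : Indep A (X ∪ ⁅ e ⁆)) → e ∉ X →
  proj₁ w e ∈ I → Indep (extend A I) (inside ∷ X)
x-for-e {A = A} {I} {X} {e} w e∉X φe∈I =
  Indep-reindex {C = extend A I} {extend A I} w′ (swapₓ e) (swapₓ-injective e) into mem
  where
  w′ : Indep (extend A I) (outside ∷ (X ∪ ⁅ e ⁆))
  w′ = lift {A = A} {I} (proj₁ w e) w

  into : ∀ y → y ∈ inside ∷ X → swapₓ e y ∈ outside ∷ (X ∪ ⁅ e ⁆)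
  into zero here = there ∈-∪⁅⁆ʳ
  into (suc y) (there y∈X) with y ≟ e
  ... | yes refl = contradiction y∈X e∉X
  ... | no _ = there (∈-∪⁅⁆ˡ y∈X)

  mem : ∀ y → y ∈ inside ∷ X → y ∈ extend A I (proj₁ w′ (swapₓ e y))
  mem zero here = x∈extend⁺ {A = A} {I} φe∈I
  mem (suc y) (there y∈X) with y ≟ e
  ... | yes refl = contradiction y∈X e∉X
  ... | no _ = there (proj₁ (proj₂ w) y (∈-∪⁅⁆ˡ y∈X))

e-for-x : ∀ {A : SetSystem n r} {I X e} (w : Indep (extend A I) (inside ∷ X)) → e ∉ X →
  e ∈ A (proj₁ w zero) → Indep A (X ∪ ⁅ e ⁆)
e-for-x {A = A} {I} {X} {e} w e∉X e∈Aₓ =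
  lower {A = A} {I}
    (Indep-reindex {C = extend A I} {extend A I} w (swapₓ e) (swapₓ-injective e) into mem)
  where
  into : ∀ y → y ∈ outside ∷ (X ∪ ⁅ e ⁆) → swapₓ e y ∈ inside ∷ X
  into (suc y) (there y∈) with y ≟ e
  ... | yes _ = here
  ... | no y≢e = there (∈-∪⁅⁆⁻ y∈ y≢e)

  mem : ∀ y → y ∈ outside ∷ (X ∪ ⁅ e ⁆) → y ∈ extend A I (proj₁ w (swapₓ e y))
  mem (suc y) (there y∈) with y ≟ e
  ... | yes refl = there e∈Aₓ
  ... | no y≢e = proj₁ (proj₂ w) (suc y) (there (∈-∪⁅⁆⁻ y∈ y≢e))

swap-x-e : ∀ {A : SetSystem n r} {I I′ X e} (w : Indep (extend A I) (inside ∷ X)) → e ∈ X →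
  e ∈ A (proj₁ w zero) → proj₁ w (suc e) ∈ I′ → Indep (extend A I′) (inside ∷ X)
swap-x-e {A = A} {I} {I′} {X} {e} w e∈X e∈Aₓ φe∈I′ =
  Indep-reindex {C = extend A I} {extend A I′} w (swapₓ e) (swapₓ-injective e) into mem
  where
  into : ∀ y → y ∈ inside ∷ X → swapₓ e y ∈ inside ∷ X
  into zero here = there e∈X
  into (suc y) (there y∈X) with y ≟ e
  ... | yes _ = here
  ... | no _ = there y∈X

  mem : ∀ y → y ∈ inside ∷ X → y ∈ extend A I′ (proj₁ w (swapₓ e y))
  mem zero here = x∈extend⁺ {A = A} {I′} φe∈I′
  mem (suc y) (there y∈X) with y ≟ e
  ... | yes refl = there e∈Aₓ
  ... | no _ = there (drop-there (proj₁ (proj₂ w) (suc y) (there y∈X)))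

Saturated : SetSystem m r → Subset m → Subset m → Fin m → Set
Saturated C S T y = y ∈ S → y ∉ T → ¬ Indep C (T ∪ ⁅ y ⁆)

Extension : SetSystem m r → Subset m → Subset m → List (Fin m) → Set
Extension {m} C S T L =
  Σ (Subset m) λ T₁ → T ⊆ T₁ × T₁ ⊆ S × Indep C T₁ × All (Saturated C S T₁) L

saturated-mono : ∀ {C : SetSystem m r} {S T T₁ y} → T ⊆ T₁ →
  Saturated C S T y → Saturated C S T₁ y
saturated-mono {C = C} T⊆T₁ sat y∈S y∉T₁ ind =
  sat y∈S (y∉T₁ ∘ T⊆T₁) (Indep-⊆ {C = C} (∪⁅⁆-mono T⊆T₁) ind)

-- One greedy step: classically, either T ∪ {y} is an independent subset of
-- S, or T itself is already saturated at y.
saturate-at : ∀ {C : SetSystem m r} {S T} y → T ⊆ S → Indep C T →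
  ¬ ¬ Extension C S T (y ∷ [])
saturate-at {C = C} {S} {T} y T⊆S indT no-extension =
  ¬¬-excluded-middle λ ind? → no-extension (step ind? (y ∈? S))
  where
  step : Dec (Indep C (T ∪ ⁅ y ⁆)) → Dec (y ∈ S) → Extension C S T (y ∷ [])
  step (yes ind) (yes y∈S) =
    T ∪ ⁅ y ⁆ , ∈-∪⁅⁆ˡ , ∪⁅⁆-least T⊆S y∈S , ind , (λ _ y∉ _ → y∉ ∈-∪⁅⁆ʳ) ∷ []
  step (no dep) _ = T , ⊆-refl , T⊆S , indT , (λ _ _ → dep) ∷ []
  step _ (no y∉S) = T , ⊆-refl , T⊆S , indT , (λ y∈S → contradiction y∈S y∉S) ∷ []

extension : ∀ {C : SetSystem m r} {S T} → T ⊆ S → Indep C T → ∀ L → ¬ ¬ Extension C S T L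
extension T⊆S indT [] no-extension = no-extension (_ , ⊆-refl , T⊆S , indT , [])
extension {C = C} T⊆S indT (y ∷ L) no-extension =
  extension {C = C} T⊆S indT L λ (T₁ , T⊆T₁ , T₁⊆S , ind₁ , sat₁) →
  saturate-at {C = C} y T₁⊆S ind₁ λ (T₂ , T₁⊆T₂ , T₂⊆S , ind₂ , sat₂) →
  no-extension (T₂ , ⊆-trans T⊆T₁ T₁⊆T₂ , T₂⊆S , ind₂ ,
                All.head sat₂ ∷ All.map (saturated-mono {C = C} T₁⊆T₂) sat₁)

-- Every independent subset of S extends to a basis of M[C]|S (a classical
-- fact, hence stated double-negated).
basis-extension : ∀ {C : SetSystem m r} {S T} → T ⊆ S → Indep C T →
  ¬ ¬ (Σ (Subset m) λ T₁ → IsBasisOf C S T₁ × T ⊆ T₁)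
basis-extension {C = C} T⊆S indT no-basis =
  extension {C = C} T⊆S indT (allFin _) λ (T₁ , T⊆T₁ , T₁⊆S , ind₁ , sat) →
  no-basis (T₁ , (T₁⊆S , ind₁ , λ y → All.lookup sat (∈-allFin y)) , T⊆T₁)

basis-x-maximal : ∀ {A : SetSystem n r} {I S T′} → IsBasisOf (extend A I) S (outside ∷ T′) →
  zero ∈ S → ¬ Indep (extend A I) (inside ∷ T′)
basis-x-maximal {A = A} {I} {T′ = T′} (_ , _ , max) x∈S ind =
  max zero x∈S (λ ()) (subst (Indep (extend A I)) (sym (x-adjoined T′)) ind)

-- A basis of M[A^I]|S avoiding x stays a basis of M[A^{I′}]|S unless x can be
-- added to it in A^{I′}: away from x the two systems agree.
basis-retarget : ∀ {A : SetSystem n r} {I I′ S T′} →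
  IsBasisOf (extend A I) S (outside ∷ T′) → ¬ Indep (extend A I′) (inside ∷ T′) →
  IsBasisOf (extend A I′) S (outside ∷ T′)
basis-retarget {A = A} {I} {I′} {S} {T′} (T⊆S , indT , max) x-dep =
  T⊆S , retarget {A = A} {I} {I′} indT (λ ()) , max′
  where
  max′ : ∀ y → y ∈ S → y ∉ outside ∷ T′ → ¬ Indep (extend A I′) ((outside ∷ T′) ∪ ⁅ y ⁆)
  max′ zero _ _ ind = x-dep (subst (Indep (extend A I′)) (x-adjoined T′) ind)
  max′ (suc y) y∈S y∉T ind = max (suc y) y∈S y∉T (retarget {A = A} {I′} {I} ind (λ ()))

coloop-x : ∀ {C : SetSystem (suc m) r} {S} → zero ∈ S →
  (∀ {T′} → ¬ IsBasisOf C S (outside ∷ T′)) → IsColoop C S zero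
coloop-x x∈S no-avoiding-basis =
  x∈S , λ { (inside ∷ T′) _ → here ; (outside ∷ T′) basis → ⊥-elim (no-avoiding-basis basis) }

-- A basis of the latter avoiding x is independent in
-- A^I, extends to a basis of the former, which contains x; so x could be
-- added to it in A^I ⊆ B^I.
coloop-transfer : ∀ {A B : SetSystem n r} → SameMatroid A B → (∀ i → A i ⊆ B i) →
  ∀ I k → XColoopDel A I k → XColoopDel B I k
coloop-transfer {A = A} {B} same A⊆B I k (_ , x∈every-basis) =
  coloop-x {C = extend B I} here no-avoiding-basis
  where
  no-avoiding-basis : ∀ {T′} → ¬ IsBasisOf (extend B I) (DelGround B k) (outside ∷ T′)
  no-avoiding-basis {T′} basis@(T⊆Sᴮ , indᴮ , _) =
    basis-extension {C = extend A I} T⊆Sᴬ indᴬ λ (T₁ , basis₁@(_ , ind₁ , _) , T⊆T₁) →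
    basis-x-maximal {A = B} {I} basis here
      (Indep-mono {C = extend A I} {extend B I} (extend-mono {I = I} A⊆B)
        (Indep-⊆ {C = extend A I} (x∷-⊆ (x∈every-basis T₁ basis₁) T⊆T₁) ind₁))
    where
    T⊆Sᴬ : outside ∷ T′ ⊆ DelGround A k
    T⊆Sᴬ = ⊆-trans T⊆Sᴮ (s⊆s (p⊆q⇒∁p⊇∁q (A⊆B k)))

    -- x gets any index: the one of the given matching will do
    indᴬ : Indep (extend A I) (outside ∷ T′)
    indᴬ = lift {A = A} {I} (proj₁ indᴮ zero) (proj₂ (same T′) (lower {A = B} {I} indᴮ))

-- A basis T′ avoiding
-- x misses B_j, so T′ ∪ {e} is independent in B (e matched to j), hence in
-- A; there e is matched into s_A(e), so x can take e's place in A^{s_A(e)}.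
coloop-at-new-index : ∀ {A B : SetSystem n r} → SameMatroid A B → (∀ i → A i ⊆ B i) →
  ∀ e j → e ∈ B j → XColoopDel B (s A e) j
coloop-at-new-index {A = A} {B} same A⊆B e j e∈Bⱼ =
  coloop-x {C = extend B (s A e)} here no-avoiding-basis
  where
  no-avoiding-basis : ∀ {T′} → ¬ IsBasisOf (extend B (s A e)) (DelGround B j) (outside ∷ T′)
  no-avoiding-basis {T′} basis@(T⊆S , indT , _) =
    basis-x-maximal {A = B} {s A e} basis here
      (Indep-mono {C = extend A (s A e)} {extend B (s A e)} (extend-mono {I = s A e} A⊆B)
        (x-for-e {A = A} {s A e} w e∉T′ (∈⇒∈s {A = A} (proj₁ (proj₂ w) e ∈-∪⁅⁆ʳ))))
    where
    T′∩Bⱼ=∅ : ∀ {t} → t ∈ T′ → t ∉ B j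
    T′∩Bⱼ=∅ t∈T′ = x∈∁p⇒x∉p (drop-there (T⊆S (there t∈T′)))

    e∉T′ : e ∉ T′
    e∉T′ e∈T′ = T′∩Bⱼ=∅ e∈T′ e∈Bⱼ

    w : Indep A (T′ ∪ ⁅ e ⁆)
    w = proj₂ (same _) (Indep-add {C = B} (lower {A = B} {s A e} indT) e∈Bⱼ T′∩Bⱼ=∅)

-- A matching of A^{s_A(e)} on T′ ∪ {x} yields one of A^{s_A(e) − h} for h ∈
-- s_A(e): unchanged if x avoids h; otherwise x trades indices with e if e ∈ T′,
-- and e replaces x if e ∉ T′.
rematch-without : ∀ (A : SetSystem n r) {T′} e h → h ∈ s A e →
  Indep (extend A (s A e)) (inside ∷ T′) →
  Indep (extend A (s A e - h)) (inside ∷ T′) ⊎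
  (e ∉ T′ × Indep (extend A (s A e - h)) (outside ∷ (T′ ∪ ⁅ e ⁆)))
rematch-without A {T′} e h h∈sₑ w@(φ , φ-mem , φ-inj) with φ zero ≟ h
... | no φx≢h =
  inj₁ (retarget {A = A} {s A e} {s A e - h} w λ _ →
         x∈p∧x≢y⇒x∈p-y (x∈extend⁻ {A = A} {s A e} (φ-mem zero here)) φx≢h)
... | yes refl with e ∈? T′
...   | no e∉T′ =
  inj₂ (e∉T′ , lift {A = A} {s A e - h} h (e-for-x {A = A} {s A e} w e∉T′ (∈s⇒∈ {A = A} h∈sₑ)))
...   | yes e∈T′ =
  inj₁ (swap-x-e {A = A} {s A e} {s A e - h} w e∈T′ (∈s⇒∈ {A = A} h∈sₑ) φe∈sₑ-h)
  where
  e∈A-φe : e ∈ A (φ (suc e))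
  e∈A-φe = drop-there (φ-mem (suc e) (there e∈T′))

  φe∈sₑ-h : φ (suc e) ∈ s A e - h
  φe∈sₑ-h = x∈p∧x≢y⇒x∈p-y (∈⇒∈s {A = A} e∈A-φe) λ φe≡φx →
    contradiction (φ-inj (suc e) zero (there e∈T′) here φe≡φx) λ ()

-- A basis T′ of the latter avoiding x would also
-- be a basis of the former unless x can be added to it in A^{s_A(e)}; and
-- then rematching enlarges T′ by x or by e in A^{s_A(e) − h}.
coloop-drop-index : ∀ (A : SetSystem n r) e h k → h ∈ s A e → k ∉ s A e →
  XColoopDel A (s A e) k → XColoopDel A (s A e - h) k
coloop-drop-index A e h k h∈sₑ k∉sₑ (_ , x∈every-basis) =
  coloop-x {C = extend A (s A e - h)} here no-avoiding-basis
  where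
  e∈S : suc e ∈ DelGround A k
  e∈S = there (x∉p⇒x∈∁p (k∉sₑ ∘ ∈⇒∈s {A = A}))

  no-avoiding-basis : ∀ {T′} → ¬ IsBasisOf (extend A (s A e - h)) (DelGround A k) (outside ∷ T′)
  no-avoiding-basis {T′} basis@(_ , _ , max) = x-addable x-not-addable
    where
    x-addable : ¬ ¬ Indep (extend A (s A e)) (inside ∷ T′)
    x-addable x-dep with x∈every-basis _ (basis-retarget {A = A} {s A e - h} {s A e} basis x-dep)
    ... | ()

    x-not-addable : ¬ Indep (extend A (s A e)) (inside ∷ T′)
    x-not-addable w =
      [ basis-x-maximal {A = A} {s A e - h} basis here
      , (λ (e∉T′ , ind) → max (suc e) e∈S (e∉T′ ∘ drop-there) ind)
      ]′ (rematch-without A e h h∈sₑ w)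

InL-intro : ∀ {A : SetSystem n r} {I} → (∀ k → k ∉ I → ¬ XColoopDel A I k) → InL A I
InL-intro no-coloop k (inj₁ k∈I) = k∈I
InL-intro no-coloop k (inj₂ (k∉I , coloop)) = ⊥-elim (no-coloop k k∉I coloop)

L-mono : ∀ {A B : SetSystem n r} {I} → SameMatroid A B → (∀ i → A i ⊆ B i) →
  InL B I → InL A I
L-mono {I = I} same A⊆B I∈L_B = InL-intro λ k k∉I coloop →
  k∉I (I∈L_B k (inj₂ (k∉I , coloop-transfer same A⊆B I k coloop)))

sA∉L_B : ∀ {A B : SetSystem n r} → SameMatroid A B → (∀ i → A i ⊆ B i) →
  ∀ e j → j ∈ s B e → j ∉ s A e → ¬ InL B (s A e)
sA∉L_B {B = B} same A⊆B e j j∈s_B j∉s_A sₑ∈L_B =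
  j∉s_A (sₑ∈L_B j (inj₂ (j∉s_A , coloop-at-new-index same A⊆B e j (∈s⇒∈ {A = B} j∈s_B))))

sA∈L_A : ∀ {A B : SetSystem n r} → SameMatroid A B → (∀ i → A i ⊆ B i) →
  ∀ e h → h ∈ s A e → InL B (s A e - h) → InL A (s A e)
sA∈L_A {A = A} same A⊆B e h h∈sₑ sₑ-h∈L_B = InL-intro λ k k∉sₑ coloop →
  k∉sₑ (p─q⊆p _ _ (L-mono same A⊆B sₑ-h∈L_B k
    (inj₂ (k∉sₑ ∘ p─q⊆p _ _ , coloop-drop-index A e h k h∈sₑ k∉sₑ coloop))))

Condition₁ : SetSystem n r → SetSystem n r → Set
Condition₁ {n} {r} A B = Σ (Fin n) λ e → Σ (Fin r) λ h →
  h ∈ s A e × InL B (s A e - h) × s A e ≢ s B e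

Condition₂ : SetSystem n r → Set
Condition₂ {n} {r} B = ∀ (I : Subset r) → ¬ InL B I → Σ (Fin r) λ h → h ∈ I × InL B (I - h)

Separated : SetSystem n r → SetSystem n r → Set
Separated {n} {r} A B = Σ (Subset r) λ I → InL A I × ¬ InL B I

sA-separates : ∀ {A B : SetSystem n r} → SameMatroid A B → (∀ i → A i ⊆ B i) →
  ∀ e h j → h ∈ s A e → InL B (s A e - h) → j ∈ s B e → j ∉ s A e → Separated A B
sA-separates {A = A} same A⊆B e h j h∈sₑ sₑ-h∈L_B j∈s_B j∉s_A =
  s A e , sA∈L_A same A⊆B e h h∈sₑ sₑ-h∈L_B , sA∉L_B same A⊆B e j j∈s_B j∉s_A

-- Under (1) the given e has some new index j.  Under (2)
-- take e ∈ B_i − A_i for an index i with A_i ⊊ B_i: then i is a new index of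
-- e, so s_A(e) ∉ L_B and (2) supplies the required h.
corollary3p11 : (n r : ℕ) (A B : SetSystem n r) →
    HasRank A r → SameMatroid A B → A ≺ B →
    ((Σ (Fin n) λ e → Σ (Fin r) λ h →
        h ∈ s A e × InL B (s A e - h) × s A e ≢ s B e)
     ⊎ (∀ (I : Subset r) → ¬ InL B I → Σ (Fin r) λ h → h ∈ I × InL B (I - h))) →
    (∀ (I : Subset r) → InL B I → InL A I) × (Σ (Subset r) λ I → InL A I × ¬ InL B I)
corollary3p11 n r A B _ same (A⊆B , i , Aᵢ≢Bᵢ) condition =
  (λ I → L-mono same A⊆B) , separated condition
  where
  separated : Condition₁ A B ⊎ Condition₂ B → Separated A B
  separated (inj₁ (e , h , h∈sₑ , sₑ-h∈L_B , sA≢sB)) =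
    let j , j∈s_B , j∉s_A = ⊆-≢-witness (s-mono A⊆B e) sA≢sB
    in sA-separates same A⊆B e h j h∈sₑ sₑ-h∈L_B j∈s_B j∉s_A
  separated (inj₂ drop-one) =
    let e , e∈Bᵢ , e∉Aᵢ = ⊆-≢-witness (A⊆B i) Aᵢ≢Bᵢ
        i∈s_B = ∈⇒∈s {A = B} e∈Bᵢ
        i∉s_A = e∉Aᵢ ∘ ∈s⇒∈ {A = A}
        h , h∈sₑ , sₑ-h∈L_B = drop-one (s A e) (sA∉L_B same A⊆B e i i∈s_B i∉s_A)
    in sA-separates same A⊆B e h i h∈sₑ sₑ-h∈L_B i∈s_B i∉s_A
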